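{- Let $V$ be a finite set of variables, let $g$ be a term with $\hat g\subseteq V$, and let $Call=((cl_1,sh_1),f_1)$ and $Prime=((cl_2,sh_2),f_2)$ be elements of $SHF^{w}$ such that every set occurring in $cl_1\cup sh_1$ is a subset of $V$ and $f_1\subseteq V$, every set occurring in $cl_2\cup sh_2$ is a subset of $\hat g$ and $f_2\subseteq\hat g$, and $(cl_2,sh_2)$ is normalized. Let $extend^{sf}(Call,g,Prime)=((cl',sh'),f')$. Let $s_1=\downarrow\!\!(cl_1)\cup sh_1$, $s_2=\downarrow\!\!(cl_2)\cup sh_2$, and $extend^f((s_1,f_1),g,(s_2,f_2))=(sh,f)$. Then \[ \downarrow\!\!(cl')\cup sh'\supseteq sh \quad\text{and}\quad f'\subseteq f. \]
   Context: For a set $S$, $\wp^0(S)$ denotes the set of nonempty subsets of $S$. Variables of interest form a finite set $V$; for a term (or atom) $t$, $\hat t$ denotes its set of variables. A sharing group is a nonempty subset of $V$; a sharing set is a set of sharing groups. A clique is a nonempty subset $C\subseteq V$, standing for all groups in $\wp^0(C)$; a clique set $cl$ is a set of cliques, and $\downarrow\!\!(cl):=\bigcup_{C\in cl}\wp^0(C)$. $SH^{w}$ consists of pairs $(cl,sh)$ of a clique set and a sharing set (representing the sharing set $\downarrow\!\!(cl)\cup sh$); $SHF^{w}$ consists of triples $((cl,sh),f)$ with $(cl,sh)\in SH^w$ and $f\subseteq V$ (the variables known to be free). Operations on a set $s$ of sets of variables: $s_1\uplus s_2=\{A\cup B\mid A\in s_1,B\in s_2\}$; $s^*$ is the closure of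 $s$ under (nonempty finite) unions; for a term $t$, $s_t=\{A\in s\mid A\cap\hat t\neq\emptyset\}$ and $\overline{s_t}=s\setminus s_t$; for a variable $x$, $s_x=\{A\in s\mid x\in A\}$; $\bigcup s$ is the union of the members of $s$. For $S\subseteq V$ and a clique set $cl$, $\overline{rel}(S,cl)=\{C\setminus S\mid C\in cl\}\setminus\{\emptyset\}$. A pair $(cl,sh)$ is normalized if whenever $s\subseteq\downarrow\!\!(cl)\cup sh$ with $s=\wp^0(c)$ for some set $c$, then $s\cap sh=\emptyset$. $normalize$ denotes a function mapping a pair $(cl,sh)$ to a normalized pair $(cl'',sh'')$ with $\downarrow\!\!(cl'')\cup sh''=\downarrow\!\!(cl)\cup sh$. Classical extend on sharing sets: $extend(Call,g,Prime)=\overline{Call_g}\cup\{s\mid s\in Call_g^*,\ (s\cap\hat g)\in Prime\}$. Sharing+Freeness extend: $extend^f((sh_1,f_1),g,(sh_2,f_2))=(sh^\dagger,f^\dagger)$ with $sh^\dagger=extend(sh_1,g,sh_2)$ and $f^\dagger=f_2\cup\{x\mid x\in f_1\setminus\hat g,\ ((\bigcup sh^\dagger_x)\cap\hat g)\subseteq f_2\}$. Clique extend: given $(cl_1,sh_1)$, $(cl_2,sh_2)$, let $(cl^\circ,sh^\circ)=normalize\big(({cl_1}_g)^*\cup(({cl_1}_g)^*\uplus({sh_1}_g)^*),\ ({sh_1}_g)^*\big)$ and $extsh=\overline{{sh_1}_g}\cup\{s\in sh^\circ\mid (s\cap\hat g)\in sh_2\}$; $extcl=\overline{rel}(\hat g,cl_1)\cup\{(s'\cap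 s)\cup(s'\setminus\hat g)\mid s'\in cl^\circ,\ s\in cl_2\}$; $clsh=\{s\mid s\subseteq c\text{ for some }c\in cl^\circ,\ (s\cap\hat g)\in sh_2\}$; $shcl=\{s\in sh^\circ\mid (s\cap\hat g)\subseteq c\text{ for some }c\in cl_2\}$; $extend^s((cl_1,sh_1),g,(cl_2,sh_2))=(extcl,\ extsh\cup clsh\cup shcl)$. Then $extend^{sf}(((cl_1,sh_1),f_1),g,((cl_2,sh_2),f_2))=((cl',sh'),f')$ where $(cl',sh')=extend^s((cl_1,sh_1),g,(cl_2,sh_2))$ and $f'=f_2\cup\{x\mid x\in f_1\setminus\hat g,\ (\bigcup(sh'_x\cup cl'_x))\cap\hat g\subseteq f_2\}$. -}

module Defs where

open import Data.Nat using (ℕ)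
open import Data.Fin using (Fin)
open import Data.Fin.Subset using (Subset; _∈_; _∉_; _⊆_; _∪_; _∩_; _─_; Nonempty)
open import Data.Product using (Σ; ∃; ∃-syntax; _×_; _,_; proj₁; proj₂)
open import Data.Sum using (_⊎_)
open import Relation.Nullary using (¬_)
open import Relation.Binary.PropositionalEquality using (_≡_)

-- Variables of interest V = Fin n; subsets of V are  Subset n.
-- A set of sets of variables (sharing set / clique set) is a predicate on Subset n.
Fam : ℕ → Set₁
Fam n = Subset n → Set

Pair : ℕ → Set₁
Pair n = Fam n × Fam n

module _ {n : ℕ} where

  AllNonempty : Fam n → Set
  AllNonempty s = ∀ A → s A → Nonempty A

  AllWithin : Fam n → Subset n → Set
  AllWithin s S = ∀ A → s A → A ⊆ S

  _∪ᶠ_ : Fam n → Fam n → Fam n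
  (s₁ ∪ᶠ s₂) A = s₁ A ⊎ s₂ A

  down : Fam n → Fam n
  down cl A = Nonempty A × ∃[ C ] (cl C × A ⊆ C)

  _⊎ᶠ_ : Fam n → Fam n → Fam n
  (s₁ ⊎ᶠ s₂) A = ∃[ B ] ∃[ C ] (s₁ B × s₂ C × A ≡ B ∪ C)

  data star (s : Fam n) : Fam n where
    gen : ∀ {A} → s A → star s A
    un  : ∀ {A B} → star s A → star s B → star s (A ∪ B)

  -- s_t (with G = t̂) and its complement s \ s_t
  rel : Fam n → Subset n → Fam n
  rel s G A = s A × Nonempty (A ∩ G)

  nrel : Fam n → Subset n → Fam n
  nrel s G A = s A × ¬ Nonempty (A ∩ G)

  relbar : Subset n → Fam n → Fam n
  relbar S cl A = Nonempty A × ∃[ C ] (cl C × A ≡ C ─ S)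

  Normalized : Pair n → Set
  Normalized (cl , sh) =
    ∀ (c : Subset n) →
    (∀ A → Nonempty A → A ⊆ c → (down cl ∪ᶠ sh) A) →
    ∀ A → Nonempty A → A ⊆ c → ¬ sh A

  IsNormalize : (Pair n → Pair n) → Set₁
  IsNormalize norm = ∀ (p : Pair n) →
    AllNonempty (proj₁ p) → AllNonempty (proj₂ p) →
    Normalized (norm p)
    × AllNonempty (proj₁ (norm p)) × AllNonempty (proj₂ (norm p))
    × (∀ A → (down (proj₁ (norm p)) ∪ᶠ proj₂ (norm p)) A → (down (proj₁ p) ∪ᶠ proj₂ p) A)
    × (∀ A → (down (proj₁ p) ∪ᶠ proj₂ p) A → (down (proj₁ (norm p)) ∪ᶠ proj₂ (norm p)) A)

  extend : Fam n → Subset n → Fam n → Fam n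
  extend call G prime A = nrel call G A ⊎ (star (rel call G) A × prime (A ∩ G))

  extendF-sh : Fam n → Subset n → Fam n → Fam n
  extendF-sh sh₁ G sh₂ = extend sh₁ G sh₂

  extendF-f : Fam n → Subset n → Subset n → Fam n → Subset n → Fin n → Set
  extendF-f sh₁ f₁ G sh₂ f₂ x =
    x ∈ f₂ ⊎
    (x ∈ f₁ × x ∉ G ×
      (∀ y → (∃[ A ] (extendF-sh sh₁ G sh₂ A × x ∈ A × y ∈ A)) → y ∈ G → y ∈ f₂))

  module CliqueExtend (norm : Pair n → Pair n)
                      (cl₁ sh₁ : Fam n) (G : Subset n) (cl₂ sh₂ : Fam n) where

    clg shg : Fam n
    clg = rel cl₁ G
    shg = rel sh₁ G

    normed : Pair n
    normed = norm ((star clg ∪ᶠ (star clg ⊎ᶠ star shg)) , star shg)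

    cl° sh° : Fam n
    cl° = proj₁ normed
    sh° = proj₂ normed

    extsh extcl clsh shcl : Fam n
    extsh A = nrel sh₁ G A ⊎ (sh° A × sh₂ (A ∩ G))
    extcl A = relbar G cl₁ A ⊎ (∃[ s' ] ∃[ s ] (cl° s' × cl₂ s × A ≡ (s' ∩ s) ∪ (s' ─ G)))
    clsh A = (∃[ c ] (cl° c × A ⊆ c)) × sh₂ (A ∩ G)
    shcl A = sh° A × ∃[ c ] (cl₂ c × A ∩ G ⊆ c)

    cl' sh' : Fam n
    cl' = extcl
    sh' = extsh ∪ᶠ (clsh ∪ᶠ shcl)

    f' : Subset n → Subset n → Fin n → Set
    f' f₁ f₂ x =
      x ∈ f₂ ⊎
      (x ∈ f₁ × x ∉ G ×
        (∀ y → (∃[ A ] ((sh' A ⊎ cl' A) × x ∈ A × y ∈ A)) → y ∈ G → y ∈ f₂))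

-- A union of relevant groups of ↓cl₁ ∪ sh₁ lies inside a union of relevant cliques of cl₁
-- (possibly joined with relevant groups of sh₁), or else is a union of relevant groups of sh₁;
-- these are exactly the cliques and groups of the pair that clique extend normalizes, and
-- normalization preserves the sharing set it represents. Splitting on whether A ∩ ĝ lies
-- under a clique of cl₂ or in sh₂ places each group A of sh in one of extcl, extsh, clsh,
-- shcl. Since every group of sh then sits under a group or clique of the clique result, the
-- freeness condition of f' is at least as demanding as that of f.
module Submission where

open import Defs
open import Algebra.Bundles using (CommutativeMonoid)
open import Data.Nat using (ℕ)
open import Data.Fin using (Fin)
open import Data.Fin.Subset using (Subset; _⊆_; _∈_; _∪_; _∩_; _─_; Nonempty)
open import Data.Fin.Subset.Properties
  using (x∈p∪q⁺; x∈p∪q⁻; x∈p∩q⁺; x∈p∩q⁻; x∈p∧x∉q⇒x∈p─q; _∈?_;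
         p⊆p∪q; q⊆p∪q; ∪-assoc; ∪-commutativeMonoid)
open import Data.Product using (_×_; _,_; proj₁; proj₂; ∃-syntax)
open import Data.Sum using (_⊎_; inj₁; inj₂; [_,_])
open import Function using (_∘_; id)
open import Relation.Nullary using (¬_; yes; no)
open import Relation.Binary.PropositionalEquality using (refl; sym; subst)

module _ {n : ℕ} where

  open import Algebra.Properties.CommutativeSemigroup
    (CommutativeMonoid.commutativeSemigroup (∪-commutativeMonoid n)) using (xy∙z≈xz∙y)

  ∪-lub : {A B C : Subset n} → A ⊆ C → B ⊆ C → A ∪ B ⊆ C
  ∪-lub {A} {B} A⊆C B⊆C x∈A∪B = [ A⊆C , B⊆C ] (x∈p∪q⁻ A B x∈A∪B)

  ∪-mono-⊆ : {A B C D : Subset n} → A ⊆ C → B ⊆ D → A ∪ B ⊆ C ∪ D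
  ∪-mono-⊆ {C = C} {D} A⊆C B⊆D = ∪-lub (p⊆p∪q D ∘ A⊆C) (q⊆p∪q C D ∘ B⊆D)

  ⊆-─ : {A C G : Subset n} → A ⊆ C → ¬ Nonempty (A ∩ G) → A ⊆ C ─ G
  ⊆-─ A⊆C A∩G≡∅ {x} x∈A =
    x∈p∧x∉q⇒x∈p─q (A⊆C x∈A) (λ x∈G → A∩G≡∅ (x , x∈p∩q⁺ (x∈A , x∈G)))

  ⊆-meet-∪-─ : {A S T G : Subset n} → A ⊆ S → A ∩ G ⊆ T → A ⊆ (S ∩ T) ∪ (S ─ G)
  ⊆-meet-∪-─ {G = G} A⊆S A∩G⊆T {x} x∈A with x ∈? G
  ... | yes x∈G = x∈p∪q⁺ (inj₁ (x∈p∩q⁺ (A⊆S x∈A , A∩G⊆T (x∈p∩q⁺ (x∈A , x∈G)))))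
  ... | no  x∉G = x∈p∪q⁺ (inj₂ (x∈p∧x∉q⇒x∈p─q (A⊆S x∈A) x∉G))

  rel-nonempty : (s : Fam n) (G : Subset n) → AllNonempty (rel s G)
  rel-nonempty s G A (_ , x , x∈A∩G) = x , proj₁ (x∈p∩q⁻ A G x∈A∩G)

  star-nonempty : {s : Fam n} → AllNonempty s → AllNonempty (star s)
  star-nonempty ne A (gen sA) = ne A sA
  star-nonempty ne _ (un {A} a _) with star-nonempty ne A a
  ... | x , x∈A = x , x∈p∪q⁺ (inj₁ x∈A)

  cliqueUnions : Fam n → Fam n → Fam n
  cliqueUnions c s = star c ∪ᶠ (star c ⊎ᶠ star s)

  module _ {c s : Fam n} where

    cliqueUnions-nonempty : AllNonempty c → AllNonempty (cliqueUnions c s)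
    cliqueUnions-nonempty ne A (inj₁ a) = star-nonempty ne A a
    cliqueUnions-nonempty ne _ (inj₂ (X , _ , x , _ , refl)) with star-nonempty ne X x
    ... | y , y∈X = y , x∈p∪q⁺ (inj₁ y∈X)

    cliqueUnions-∪-star : ∀ {C B} → cliqueUnions c s C → star s B →
                          cliqueUnions c s (C ∪ B)
    cliqueUnions-∪-star {C} {B} (inj₁ x) b = inj₂ (C , B , x , b , refl)
    cliqueUnions-∪-star {B = B} (inj₂ (X , Y , x , y , refl)) b =
      inj₂ (X , Y ∪ B , x , un y b , ∪-assoc X Y B)

    star-∪-cliqueUnions : ∀ {X D} → star c X → cliqueUnions c s D →
                          cliqueUnions c s (X ∪ D)
    star-∪-cliqueUnions x (inj₁ d) = inj₁ (un x d)
    star-∪-cliqueUnions {X} x (inj₂ (X' , Y' , x' , y' , refl)) =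
      inj₂ (X ∪ X' , Y' , un x x' , y' , sym (∪-assoc X X' Y'))

    cliqueUnions-∪ : ∀ {C D} → cliqueUnions c s C → cliqueUnions c s D →
                     cliqueUnions c s (C ∪ D)
    cliqueUnions-∪ (inj₁ x) d = star-∪-cliqueUnions x d
    cliqueUnions-∪ {D = D} (inj₂ (X , Y , x , y , refl)) d =
      subst (cliqueUnions c s) (xy∙z≈xz∙y X D Y)
            (cliqueUnions-∪-star (star-∪-cliqueUnions x d) y)

    Covered : Fam n
    Covered A = (∃[ C ] (cliqueUnions c s C × A ⊆ C)) ⊎ star s A

    Covered-∪ : ∀ {A B} → Covered A → Covered B → Covered (A ∪ B)
    Covered-∪ (inj₁ (C , c , A⊆C)) (inj₁ (D , d , B⊆D)) =
      inj₁ (C ∪ D , cliqueUnions-∪ c d , ∪-mono-⊆ A⊆C B⊆D)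
    Covered-∪ (inj₁ (C , c , A⊆C)) (inj₂ b) =
      inj₁ (_ , cliqueUnions-∪-star c b , ∪-mono-⊆ A⊆C id)
    Covered-∪ {A} (inj₂ a) (inj₁ (D , d , B⊆D)) =
      inj₁ (D ∪ A , cliqueUnions-∪-star d a , ∪-lub (q⊆p∪q D A) (p⊆p∪q A ∘ B⊆D))
    Covered-∪ (inj₂ a) (inj₂ b) = inj₂ (un a b)

    star-Covered : {t : Fam n} → (∀ {A} → t A → (∃[ C ] (c C × A ⊆ C)) ⊎ s A) →
                   ∀ {A} → star t A → Covered A
    star-Covered split (gen tA) with split tA
    ... | inj₁ (C , cC , A⊆C) = inj₁ (C , inj₁ (gen cC) , A⊆C)
    ... | inj₂ sA = inj₂ (gen sA)
    star-Covered split (un a b) = Covered-∪ (star-Covered split a) (star-Covered split b)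

  rel-down-∪ : {cl sh : Fam n} {G A : Subset n} → rel (down cl ∪ᶠ sh) G A →
               (∃[ C ] (rel cl G C × A ⊆ C)) ⊎ rel sh G A
  rel-down-∪ {G = G} {A} (inj₁ (_ , C , clC , A⊆C) , x , x∈A∩G) =
    let x∈A , x∈G = x∈p∩q⁻ A G x∈A∩G in
    inj₁ (C , (clC , x , x∈p∩q⁺ (A⊆C x∈A , x∈G)) , A⊆C)
  rel-down-∪ (inj₂ shA , meets) = inj₂ (shA , meets)

  module _ (norm : Pair n → Pair n) (isNormalize : IsNormalize norm)
           (cl₁ sh₁ : Fam n) (G : Subset n) (cl₂ sh₂ : Fam n) where

    open CliqueExtend norm cl₁ sh₁ G cl₂ sh₂

    star-rel⇒normed : ∀ {A} → star (rel (down cl₁ ∪ᶠ sh₁) G) A → (down cl° ∪ᶠ sh°) A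
    star-rel⇒normed {A} a = represents A (covered (star-Covered (rel-down-∪ {cl₁} {sh₁}) a))
      where
        represents : ∀ A → (down (cliqueUnions clg shg) ∪ᶠ star shg) A → (down cl° ∪ᶠ sh°) A
        represents = proj₂ (proj₂ (proj₂ (proj₂
          (isNormalize _ (cliqueUnions-nonempty (rel-nonempty cl₁ G))
                         (star-nonempty (rel-nonempty sh₁ G))))))

        covered : Covered {clg} {shg} A → (down (cliqueUnions clg shg) ∪ᶠ star shg) A
        covered (inj₁ (C , cuC , A⊆C)) =
          inj₁ (star-nonempty (rel-nonempty _ G) A a , C , cuC , A⊆C)
        covered (inj₂ shA) = inj₂ shA

    extend⊆cliqueExtend : ∀ A → extend (down cl₁ ∪ᶠ sh₁) G (down cl₂ ∪ᶠ sh₂) A →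
                          (down cl' ∪ᶠ sh') A
    extend⊆cliqueExtend A (inj₁ (inj₁ ((x , x∈A) , C , clC , A⊆C) , A∩G≡∅)) =
      inj₁ ((x , x∈A) , C ─ G , inj₁ ((x , A⊆C─G x∈A) , C , clC , refl) , A⊆C─G)
      where
        A⊆C─G : A ⊆ C ─ G
        A⊆C─G = ⊆-─ A⊆C A∩G≡∅
    extend⊆cliqueExtend A (inj₁ (inj₂ shA , A∩G≡∅)) = inj₂ (inj₁ (inj₁ (shA , A∩G≡∅)))
    extend⊆cliqueExtend A (inj₂ (a , prime)) with star-rel⇒normed a | prime
    ... | inj₂ sh°A | inj₂ sh₂A∩G = inj₂ (inj₁ (inj₂ (sh°A , sh₂A∩G)))
    ... | inj₂ sh°A | inj₁ (_ , c , cl₂c , A∩G⊆c) =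
      inj₂ (inj₂ (inj₂ (sh°A , c , cl₂c , A∩G⊆c)))
    ... | inj₁ (_ , c , cl°c , A⊆c) | inj₂ sh₂A∩G =
      inj₂ (inj₂ (inj₁ ((c , cl°c , A⊆c) , sh₂A∩G)))
    ... | inj₁ (neA , s' , cl°s' , A⊆s') | inj₁ (_ , s , cl₂s , A∩G⊆s) =
      inj₁ (neA , (s' ∩ s) ∪ (s' ─ G) , inj₂ (s' , s , cl°s' , cl₂s , refl) ,
            ⊆-meet-∪-─ A⊆s' A∩G⊆s)

    cliqueExtend-f⊆extendF-f : (f₁ f₂ : Subset n) (x : Fin n) → f' f₁ f₂ x →
                               extendF-f (down cl₁ ∪ᶠ sh₁) f₁ G (down cl₂ ∪ᶠ sh₂) f₂ x
    cliqueExtend-f⊆extendF-f f₁ f₂ x (inj₁ x∈f₂) = inj₁ x∈f₂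
    cliqueExtend-f⊆extendF-f f₁ f₂ x (inj₂ (x∈f₁ , x∉G , free)) =
      inj₂ (x∈f₁ , x∉G , free†)
      where
        free† : ∀ y →
                (∃[ A ] (extend (down cl₁ ∪ᶠ sh₁) G (down cl₂ ∪ᶠ sh₂) A × x ∈ A × y ∈ A)) →
                y ∈ G → y ∈ f₂
        free† y (A , ext , x∈A , y∈A) with extend⊆cliqueExtend A ext
        ... | inj₁ (_ , C , cl'C , A⊆C) = free y (C , inj₂ cl'C , A⊆C x∈A , A⊆C y∈A)
        ... | inj₂ sh'A = free y (A , inj₁ sh'A , x∈A , y∈A)

theorem2 : (n : ℕ) (G : Subset n) (cl₁ sh₁ cl₂ sh₂ : Fam n) (f₁ f₂ : Subset n)
           (norm : Pair n → Pair n) → IsNormalize norm →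
           AllNonempty cl₁ → AllNonempty sh₁ → AllNonempty cl₂ → AllNonempty sh₂ →
           AllWithin cl₂ G → AllWithin sh₂ G → f₂ ⊆ G →
           Normalized (cl₂ , sh₂) →
           (∀ A → extendF-sh (down cl₁ ∪ᶠ sh₁) G (down cl₂ ∪ᶠ sh₂) A →
                  (down (CliqueExtend.cl' norm cl₁ sh₁ G cl₂ sh₂)
                    ∪ᶠ CliqueExtend.sh' norm cl₁ sh₁ G cl₂ sh₂) A)
           × (∀ (x : Fin n) → CliqueExtend.f' norm cl₁ sh₁ G cl₂ sh₂ f₁ f₂ x →
                  extendF-f (down cl₁ ∪ᶠ sh₁) f₁ G (down cl₂ ∪ᶠ sh₂) f₂ x)
theorem2 n G cl₁ sh₁ cl₂ sh₂ f₁ f₂ norm isNormalize _ _ _ _ _ _ _ _ =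
  extend⊆cliqueExtend norm isNormalize cl₁ sh₁ G cl₂ sh₂ ,
  cliqueExtend-f⊆extendF-f norm isNormalize cl₁ sh₁ G cl₂ sh₂ f₁ f₂
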